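{- The competitive ratio of First-Fit on the class of 2-count interval graphs is at most $4$.
   Context: A 2-count interval graph is a graph having an interval representation (an assignment of closed real intervals to vertices such that two vertices are adjacent iff their intervals intersect) in which at most two distinct interval lengths occur. First-Fit is the online coloring algorithm that receives the vertices one at a time and assigns each vertex the least positive integer color not used on its previously presented neighbours. For an online algorithm $A$ and graph $G$, $\chi_A(G)$ is the maximum number of colors $A$ uses over all orderings of the vertices of $G$. $A$ is $\rho$-competitive on a class if there is $b\in\mathbb{R}$ with $\chi_A(G)\le\rho\chi(G)+b$ for every $G$ in the class; the competitive ratio of $A$ is the infimum of such $\rho$.
   Formalization: In the 2-count interval representations, the interval endpoints and the two interval lengths are rational rather than real. -}

module Defs where

open import Data.Nat using (ℕ; zero; suc; _⊔_; _≡ᵇ_)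
open import Data.Bool using (Bool; true; false; if_then_else_)
open import Data.Fin using (Fin)
open import Data.List using (List; []; _∷_; length; foldr; map)
open import Data.Bool.ListAction using (any)
open import Data.Product using (_×_; _,_; Σ; ∃-syntax)
open import Data.Sum using (_⊎_)
open import Data.Rational using (ℚ; _≤_; _-_)
open import Relation.Binary.PropositionalEquality using (_≡_; _≢_)
open import Relation.Nullary using (¬_)
open import Function.Bundles using (_⇔_)

record Graph : Set where
  field
    n      : ℕ
    adj    : Fin n → Fin n → Bool
    irrefl : ∀ i → adj i i ≡ false
    sym    : ∀ i j → adj i j ≡ adj j i
open Graph public

record IntervalRep (G : Graph) : Set where
  field
    l r   : Fin (n G) → ℚ
    l≤r   : ∀ i → l i ≤ r i
    exact : ∀ i j → i ≢ j → (adj G i j ≡ true ⇔ (l i ≤ r j × l j ≤ r i))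
open IntervalRep public

TwoCount : {G : Graph} → IntervalRep G → Set
TwoCount ρ = Σ ℚ λ a → Σ ℚ λ b → ∀ i → (r ρ i - l ρ i ≡ a) ⊎ (r ρ i - l ρ i ≡ b)

Is2CountInterval : Graph → Set
Is2CountInterval G = Σ (IntervalRep G) TwoCount

ProperColouring : (G : Graph) → (k : ℕ) → (Fin (n G) → Fin k) → Set
ProperColouring G k c = ∀ i j → adj G i j ≡ true → c i ≢ c j

Colourable : Graph → ℕ → Set
Colourable G k = ∃[ c ] ProperColouring G k c

IsChromaticNumber : Graph → ℕ → Set
IsChromaticNumber G k = Colourable G k × (∀ m → Colourable G m → k Data.Nat.≤ m)

leastFreeFrom : ℕ → ℕ → List ℕ → ℕ
leastFreeFrom zero    c L = c
leastFreeFrom (suc f) c L = if any (λ x → x ≡ᵇ c) L then leastFreeFrom f (suc c) L else c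

leastFree : List ℕ → ℕ
leastFree L = leastFreeFrom (suc (length L)) 1 L

nbrColours : (G : Graph) → Fin (n G) → List (Fin (n G) × ℕ) → List ℕ
nbrColours G v []            = []
nbrColours G v ((u , c) ∷ A) =
  if adj G v u then c ∷ nbrColours G v A else nbrColours G v A

firstFitAcc : (G : Graph) → List (Fin (n G) × ℕ) → List (Fin (n G)) → List (Fin (n G) × ℕ)
firstFitAcc G A []       = A
firstFitAcc G A (v ∷ vs) = firstFitAcc G ((v , leastFree (nbrColours G v A)) ∷ A) vs

firstFit : (G : Graph) → List (Fin (n G)) → List (Fin (n G) × ℕ)
firstFit G σ = firstFitAcc G [] σ

-- number of colours used = largest colour assigned (colours are 1,2,...)
coloursUsed : (G : Graph) → List (Fin (n G)) → ℕ
coloursUsed G σ = foldr (λ p m → Data.Product.proj₂ p ⊔ m) 0 (firstFit G σ)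

open import Data.List.Relation.Binary.Permutation.Propositional using (_↭_)
open import Data.List using (allFin)

Ordering : Graph → Set
Ordering G = Σ (List (Fin (n G))) λ σ → σ ↭ allFin (n G)

{-# OPTIONS --safe #-}
module Submission where

-- When First-Fit gives v the colour c, every colour below c occurs on a neighbour u
-- of v, and u either contains an endpoint of v or lies strictly inside v.  The
-- intervals through a point form a clique, so each endpoint of v accounts for at most
-- χ colours.  An interval strictly inside v is strictly shorter than v; as only two
-- lengths occur, no interval lies strictly inside it, so the same count bounds its
-- colour by 2χ + 1.  Hence c ≤ χ + χ + (2χ + 1) + 1 = 4χ + 2, which gives the
-- statement with b = 2(k + 1).

open import Defs
open import Data.Nat using (ℕ; suc; _+_; _*_; _≤_)
open import Data.Product using (Σ; proj₁)

open import Data.Bool using (true; false)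
open import Data.Bool.ListAction using (any)
open import Data.Bool.Properties using (T-≡)
open import Data.Empty using (⊥)
open import Data.Fin using (Fin; toℕ; fromℕ<; _≟_)
open import Data.Fin.Properties using (injective⇒≤; +↔⊎; toℕ<n; toℕ-fromℕ<; toℕ-injective)
open import Data.List using (List; []; _∷_; length; map; foldr; allFin; reverse; _ʳ++_)
open import Data.List.Membership.Propositional using (_∈_)
open import Data.List.Membership.Propositional.Properties using (∈-map⁺)
open import Data.List.Relation.Binary.Permutation.Propositional using (_↭_; ↭-sym; ↭-trans; ↭⇒↭ₛ)
open import Data.List.Relation.Binary.Permutation.Propositional.Properties using (↭-reverse)
open import Data.List.Relation.Binary.Permutation.Setoid.Properties using (Unique-resp-↭)
import Data.List.Relation.Unary.All as All
open import Data.List.Relation.Unary.Any as Any using (here; there)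
open import Data.List.Relation.Unary.Any.Properties using (any⁻)
open import Data.List.Relation.Unary.AllPairs using (_∷_)
open import Data.List.Relation.Unary.Unique.Propositional using (Unique)
open import Data.List.Relation.Unary.Unique.Propositional.Properties using (allFin⁺)
open import Data.Nat using (zero; _<_; _⊔_; _≡ᵇ_; z≤n; s≤s)
open import Data.Nat.Properties
  using (≤-trans; ≤⇒≯; ≡ᵇ⇒≡; m≤n⇒m<n∨m≡n; ⊔-lub; m≤m+n; *-monoʳ-≤; suc-injective; ≤-reflexive; module ≤-Reasoning)
open import Data.Nat.Tactic.RingSolver using (solve-∀)
open import Data.Product using (_×_; _,_; proj₂; ∃-syntax)
open import Data.Rational using (ℚ; _-_)
import Data.Rational as ℚ
import Data.Rational.Properties as ℚ
open import Data.Sum using (_⊎_; inj₁; inj₂)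
open import Data.Sum.Function.Propositional using (_⊎-↔_)
open import Function using (_∘_; _↔_; _↣_; Injection; Injective)
open import Function.Bundles using (Equivalence)
open import Function.Properties.Inverse using (↔-refl; ↔-sym; ↔-trans; ↔⇒↣)
open import Level using (Level)
open import Relation.Binary using (Rel; Irreflexive; Transitive)
open import Relation.Binary.PropositionalEquality using (_≡_; _≢_; refl; subst; setoid)
import Relation.Binary.PropositionalEquality as ≡
open import Relation.Nullary using (¬_; yes; no; contradiction)

private
  variable
    ℓ : Level
    A B X : Set

injective-choice⇒≤ : ∀ {m n} → X ↣ Fin n → (R : Fin m → X → Set ℓ) →
                     (∀ i → Σ X (R i)) → (∀ {i i′ x} → R i x → R i′ x → i ≡ i′) → m ≤ n
injective-choice⇒≤ {X = X} {m = m} ι R choose unique = injective⇒≤ injective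
  where
  slot : Fin m → X
  slot = proj₁ ∘ choose

  injective : Injective _≡_ _≡_ (Injection.to ι ∘ slot)
  injective {i} {i′} e =
    unique (proj₂ (choose i)) (subst (R i′) (≡.sym (Injection.injective ι e)) (proj₂ (choose i′)))

+↔⊎³ : ∀ a b c → Fin (a + (b + c)) ↔ (Fin a ⊎ Fin b ⊎ Fin c)
+↔⊎³ a b c = ↔-trans +↔⊎ (↔-refl ⊎-↔ +↔⊎)

two-of-three-equal : ∀ {a b x y z : A} → x ≡ a ⊎ x ≡ b → y ≡ a ⊎ y ≡ b → z ≡ a ⊎ z ≡ b →
                     x ≡ y ⊎ y ≡ z ⊎ x ≡ z
two-of-three-equal (inj₁ refl) (inj₁ refl) _           = inj₁ refl
two-of-three-equal (inj₂ refl) (inj₂ refl) _           = inj₁ refl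
two-of-three-equal (inj₁ refl) (inj₂ refl) (inj₁ refl) = inj₂ (inj₂ refl)
two-of-three-equal (inj₁ refl) (inj₂ refl) (inj₂ refl) = inj₂ (inj₁ refl)
two-of-three-equal (inj₂ refl) (inj₁ refl) (inj₁ refl) = inj₂ (inj₁ refl)
two-of-three-equal (inj₂ refl) (inj₁ refl) (inj₂ refl) = inj₂ (inj₂ refl)

module _ {_<_ : Rel A ℓ} (irrefl : Irreflexive _≡_ _<_) (<-trans : Transitive _<_) where

  no-<-chain-in-pair : ∀ {a b x y z} → x ≡ a ⊎ x ≡ b → y ≡ a ⊎ y ≡ b → z ≡ a ⊎ z ≡ b →
                       x < y → y < z → ⊥
  no-<-chain-in-pair x∈ y∈ z∈ x<y y<z with two-of-three-equal x∈ y∈ z∈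
  ... | inj₁ x≡y        = irrefl x≡y x<y
  ... | inj₂ (inj₁ y≡z) = irrefl y≡z y<z
  ... | inj₂ (inj₂ x≡z) = irrefl x≡z (<-trans x<y y<z)

unique-keys⇒functional : ∀ {xs : List (A × B)} {k b b′} → Unique (map proj₁ xs) →
                         (k , b) ∈ xs → (k , b′) ∈ xs → b ≡ b′
unique-keys⇒functional _            (here refl) (here refl) = refl
unique-keys⇒functional (k∉ ∷ _)     (here refl) (there m′)  =
  contradiction refl (All.lookup k∉ (∈-map⁺ proj₁ m′))
unique-keys⇒functional (k∉ ∷ _)     (there m)   (here refl) =
  contradiction refl (All.lookup k∉ (∈-map⁺ proj₁ m))
unique-keys⇒functional (_ ∷ unique) (there m)   (there m′)  = unique-keys⇒functional unique m m′

foldr-⊔-≤ : ∀ (f : A → ℕ) (xs : List A) {M} → (∀ {x} → x ∈ xs → f x ≤ M) →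
            foldr (λ x m → f x ⊔ m) 0 xs ≤ M
foldr-⊔-≤ f []       bound = z≤n
foldr-⊔-≤ f (x ∷ xs) bound = ⊔-lub (bound (here refl)) (foldr-⊔-≤ f xs (bound ∘ there))

leastFreeFrom-gap : ∀ fuel s L {j} → s ≤ j → j < leastFreeFrom fuel s L → j ∈ L
leastFreeFrom-gap zero s L s≤j j<s = contradiction j<s (≤⇒≯ s≤j)
leastFreeFrom-gap (suc fuel) s L s≤j j<lf with any (λ x → x ≡ᵇ s) L in found
... | false = contradiction j<lf (≤⇒≯ s≤j)
... | true with m≤n⇒m<n∨m≡n s≤j
...   | inj₁ s<j  = leastFreeFrom-gap fuel (suc s) L s<j j<lf
...   | inj₂ refl = Any.map (λ {x} x≡ᵇs → ≡.sym (≡ᵇ⇒≡ x s x≡ᵇs))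
                            (any⁻ _ L (Equivalence.from T-≡ found))

leastFree-gap : ∀ L {j} → suc j < leastFree L → suc j ∈ L
leastFree-gap L = leastFreeFrom-gap (suc (length L)) 1 L (s≤s z≤n)

adjacent⇒≢ : ∀ (G : Graph) {u v} → adj G u v ≡ true → u ≢ v
adjacent⇒≢ G {u} u~u refl with ≡.trans (≡.sym u~u) (irrefl G u)
... | ()

module FirstFitRun (G : Graph) where

  Assignment : Set
  Assignment = List (Fin (n G) × ℕ)

  Functional : Assignment → Set
  Functional A = ∀ {v c c′} → (v , c) ∈ A → (v , c′) ∈ A → c ≡ c′

  Grundy : Assignment → Set
  Grundy A = ∀ {v c j} → (v , c) ∈ A → suc j < c → ∃[ u ] ((u , suc j) ∈ A × adj G v u ≡ true)

  nbrColours-neighbour : ∀ {v c} A → c ∈ nbrColours G v A → ∃[ u ] ((u , c) ∈ A × adj G v u ≡ true)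
  nbrColours-neighbour {v} ((u , c′) ∷ A) c∈ with adj G v u in v~u | c∈
  ... | true  | here refl = u , here refl , v~u
  ... | true  | there c∈A = let w , w∈ , v~w = nbrColours-neighbour A c∈A in w , there w∈ , v~w
  ... | false | c∈A       = let w , w∈ , v~w = nbrColours-neighbour A c∈A in w , there w∈ , v~w

  grundy-step : ∀ {v A} → Grundy A → Grundy ((v , leastFree (nbrColours G v A)) ∷ A)
  grundy-step {A = A} grundy (here refl) j<c =
    let u , u∈ , v~u = nbrColours-neighbour A (leastFree-gap _ j<c) in u , there u∈ , v~u
  grundy-step grundy (there v∈) j<c =
    let u , u∈ , v~u = grundy v∈ j<c in u , there u∈ , v~u

  firstFitAcc-grundy : ∀ {A} σ → Grundy A → Grundy (firstFitAcc G A σ)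
  firstFitAcc-grundy []      grundy = grundy
  firstFitAcc-grundy (v ∷ σ) grundy = firstFitAcc-grundy σ (grundy-step grundy)

  firstFit-grundy : ∀ σ → Grundy (firstFit G σ)
  firstFit-grundy σ = firstFitAcc-grundy σ (λ ())

  firstFitAcc-vertices : ∀ A σ → map proj₁ (firstFitAcc G A σ) ≡ σ ʳ++ map proj₁ A
  firstFitAcc-vertices A []      = refl
  firstFitAcc-vertices A (v ∷ σ) = firstFitAcc-vertices _ σ

  firstFit-functional : ∀ {σ} → σ ↭ allFin (n G) → Functional (firstFit G σ)
  firstFit-functional {σ} σ↭ =
    unique-keys⇒functional (subst Unique (≡.sym (firstFitAcc-vertices [] σ)) unique-reverse)
    where
    unique-reverse : Unique (reverse σ)
    unique-reverse =
      Unique-resp-↭ (setoid _) (↭⇒↭ₛ (↭-sym (↭-trans (↭-reverse σ) σ↭))) (allFin⁺ (n G))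

module Intervals {G : Graph} (ρ : IntervalRep G) where

  Contains : Fin (n G) → ℚ → Set
  Contains u x = l ρ u ℚ.≤ x × x ℚ.≤ r ρ u

  _⊏_ : Fin (n G) → Fin (n G) → Set
  u ⊏ v = l ρ v ℚ.< l ρ u × r ρ u ℚ.< r ρ v

  len : Fin (n G) → ℚ
  len u = r ρ u - l ρ u

  ⊏⇒len< : ∀ {u v} → u ⊏ v → len u ℚ.< len v
  ⊏⇒len< (l<l , r<r) = ℚ.+-mono-< r<r (ℚ.neg-antimono-< l<l)

  common-point⇒adjacent : ∀ {u w x} → u ≢ w → Contains u x → Contains w x → adj G u w ≡ true
  common-point⇒adjacent u≢w (lu≤x , x≤ru) (lw≤x , x≤rw) =
    Equivalence.from (exact ρ _ _ u≢w) (ℚ.≤-trans lu≤x x≤rw , ℚ.≤-trans lw≤x x≤ru)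

  neighbour-position : ∀ {v u} → adj G v u ≡ true →
                       Contains u (l ρ v) ⊎ Contains u (r ρ v) ⊎ u ⊏ v
  neighbour-position {v} {u} v~u with Equivalence.to (exact ρ v u (adjacent⇒≢ G v~u)) v~u
  ... | lv≤ru , lu≤rv with l ρ u ℚ.≤? l ρ v | r ρ v ℚ.≤? r ρ u
  ...   | yes lu≤lv | _         = inj₁ (lu≤lv , lv≤ru)
  ...   | no  _     | yes rv≤ru = inj₂ (inj₁ (lu≤rv , rv≤ru))
  ...   | no  lu≰lv | no  rv≰ru = inj₂ (inj₂ (ℚ.≰⇒> lu≰lv , ℚ.≰⇒> rv≰ru))

  twoCount⇒no-⊏-chain : TwoCount ρ → ∀ {w u v} → w ⊏ u → u ⊏ v → ⊥
  twoCount⇒no-⊏-chain (_ , _ , two) {w} {u} {v} w⊏u u⊏v =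
    no-<-chain-in-pair ℚ.<-irrefl ℚ.<-trans (two w) (two u) (two v) (⊏⇒len< w⊏u) (⊏⇒len< u⊏v)

2χ+[2χ+1]+1≡4χ+2 : ∀ χ → suc (χ + (χ + suc (χ + (χ + 0)))) ≡ 4 * χ + 2
2χ+[2χ+1]+1≡4χ+2 = solve-∀

module ColourBound {G : Graph} (ρ : IntervalRep G) {χ} {col : Fin (n G) → Fin χ}
                   (proper : ProperColouring G χ col)
                   {A : FirstFitRun.Assignment G}
                   (functional : FirstFitRun.Functional G A) (grundy : FirstFitRun.Grundy G A) where
  open Intervals ρ

  UsedAt : ℚ → ℕ → Fin χ → Set
  UsedAt x j k = ∃[ u ] ((u , suc j) ∈ A × Contains u x × col u ≡ k)

  usedAt-injective : ∀ {x j j′ k} → UsedAt x j k → UsedAt x j′ k → j ≡ j′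
  usedAt-injective (u , u∈ , u∋x , refl) (u′ , u′∈ , u′∋x , col≡) with u ≟ u′
  ... | yes refl = suc-injective (functional u∈ u′∈)
  ... | no  u≢u′ = contradiction (≡.sym col≡) (proper u u′ (common-point⇒adjacent u≢u′ u∋x u′∋x))

  -- A colour suc j below that of v is charged to the proper colour of a neighbour
  -- carrying it through an endpoint of v or, when it is carried inside v, to j itself.
  Slot : Fin (n G) → ∀ B → ℕ → Fin χ ⊎ Fin χ ⊎ Fin B → Set
  Slot v B j (inj₁ k)        = UsedAt (l ρ v) j k
  Slot v B j (inj₂ (inj₁ k)) = UsedAt (r ρ v) j k
  Slot v B j (inj₂ (inj₂ k)) = toℕ k ≡ j

  slot-injective : ∀ {v B j j′} s → Slot v B j s → Slot v B j′ s → j ≡ j′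
  slot-injective (inj₁ k)        = usedAt-injective
  slot-injective (inj₂ (inj₁ k)) = usedAt-injective
  slot-injective (inj₂ (inj₂ k)) k≡j k≡j′ = ≡.trans (≡.sym k≡j) k≡j′

  colour-bound : ∀ B {v c} → (v , c) ∈ A → (∀ {u j} → (u , j) ∈ A → u ⊏ v → j ≤ B) →
                 c ≤ suc (χ + (χ + B))
  colour-bound B {c = zero}  _  _     = z≤n
  colour-bound B {v} {suc c} v∈ inner =
    s≤s (injective-choice⇒≤ (↔⇒↣ (↔-sym (+↔⊎³ χ χ B))) (Slot v B ∘ toℕ) choose
          (λ {_} {_} {s} Ri Ri′ → toℕ-injective (slot-injective s Ri Ri′)))
    where
    choose : ∀ i → Σ (Fin χ ⊎ Fin χ ⊎ Fin B) (Slot v B (toℕ i))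
    choose i with grundy v∈ (s≤s (toℕ<n i))
    ... | u , u∈ , v~u with neighbour-position v~u
    ...   | inj₁ u∋lv        = inj₁ (col u) , u , u∈ , u∋lv , refl
    ...   | inj₂ (inj₁ u∋rv) = inj₂ (inj₁ (col u)) , u , u∈ , u∋rv , refl
    ...   | inj₂ (inj₂ u⊏v)  = inj₂ (inj₂ (fromℕ< (inner u∈ u⊏v))) , toℕ-fromℕ< _

  innermost-colour-bound : ∀ {v c} → (v , c) ∈ A → (∀ w → ¬ w ⊏ v) → c ≤ suc (χ + (χ + 0))
  innermost-colour-bound v∈ innermost =
    colour-bound 0 v∈ (λ {w} _ w⊏v → contradiction w⊏v (innermost w))

  twoCount-colour-bound : TwoCount ρ → ∀ {v c} → (v , c) ∈ A → c ≤ 4 * χ + 2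
  twoCount-colour-bound twoCount v∈ = ≤-trans
    (colour-bound _ v∈ λ u∈ u⊏v →
      innermost-colour-bound u∈ λ w w⊏u → twoCount⇒no-⊏-chain twoCount w⊏u u⊏v)
    (≤-reflexive (2χ+[2χ+1]+1≡4χ+2 χ))

firstFit-2count-bound : ∀ {G} → Is2CountInterval G → ∀ {χ} → Colourable G χ →
                        ∀ {σ} → σ ↭ allFin (n G) → coloursUsed G σ ≤ 4 * χ + 2
firstFit-2count-bound {G} (ρ , twoCount) (col , proper) {σ} σ↭ =
  foldr-⊔-≤ proj₂ (firstFit G σ) (twoCount-colour-bound twoCount)
  where open FirstFitRun G
        open ColourBound ρ proper (firstFit-functional σ↭) (firstFit-grundy σ)

scaled-bound : ∀ k χ → suc k * (4 * χ + 2) + χ ≡ (4 * suc k + 1) * χ + suc k * 2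
scaled-bound = solve-∀

theorem15 : (k : ℕ) → Σ ℕ λ b →
    (G : Graph) → Is2CountInterval G → (χ : ℕ) → IsChromaticNumber G χ →
    (σ : Ordering G) →
    suc k * coloursUsed G (proj₁ σ) ≤ (4 * suc k + 1) * χ + b
theorem15 k = suc k * 2 , λ G twoCount χ (colourable , _) (σ , σ↭) → begin
  suc k * coloursUsed G σ          ≤⟨ *-monoʳ-≤ (suc k) (firstFit-2count-bound twoCount colourable σ↭) ⟩
  suc k * (4 * χ + 2)              ≤⟨ m≤m+n _ χ ⟩
  suc k * (4 * χ + 2) + χ          ≡⟨ scaled-bound k χ ⟩
  (4 * suc k + 1) * χ + suc k * 2  ∎
  where open ≤-Reasoning
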